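{- Let $H$ be a hypergraph, $k$ a nonnegative integer, $U\subseteq V(H)$, $s,t\in U$, and $S\subseteq U\setminus\{s,t\}$. Then $S$ is an $s,t$-separator of $H$ with edge cover number at most $k$ if and only if $S$ is an $s,t$-separator of $\mathrm{Torso}^*(H,U)$ that is dominated by at most $k$ vertices of $V(\mathrm{Torso}^*(H,U))\setminus V(\mathrm{Torso}(H,U))$.
   Context: A hypergraph $H$ has a finite vertex set $V(H)$ and a family $E(H)$ of subsets (hyperedges), with no isolated vertices. A path in $H$ is a sequence of vertices with consecutive vertices in a common hyperedge. An $s,t$-separator (in a hypergraph or graph) is a vertex set not containing $s,t$ whose deletion leaves no path between $s$ and $t$. The edge cover number of $S$ is the least number of hyperedges of $H$ whose union contains $S$. For $U\subseteq V(H)$, $\mathrm{Torso}(H,U)$ is the graph with vertex set $U$ in which distinct $u,v$ are adjacent iff $H$ has a path from $u$ to $v$ all of whose intermediate vertices lie outside $U$. The extended torso $\mathrm{Torso}^*(H,U)$ is obtained from $\mathrm{Torso}(H,U)$ by adding, for each hyperedge $e_i$ of $H$ with $e_i\cap U\ne\emptyset$, a new vertex $u_i$ adjacent to exactly the vertices of $U\cap e_i$. A set $D$ dominates $S$ if every vertex of $S$ is adjacent to some vertex of $D$. -}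

module Defs where

open import Data.Nat using (ℕ; _≤_)
open import Data.Fin using (Fin)
open import Data.Fin.Subset using (Subset; _∈_; _∉_)
open import Data.Sum using (_⊎_; inj₁; inj₂)
open import Data.Product using (Σ; ∃; ∃-syntax; _×_)
open import Data.Empty using (⊥)
open import Data.Unit using (⊤)
open import Data.List using (List; length)
open import Data.List.Membership.Propositional using () renaming (_∈_ to _∈ₗ_)
open import Relation.Nullary using (¬_)
open import Relation.Binary.PropositionalEquality using (_≢_)

record Hypergraph (n m : ℕ) : Set where
  field
    edge       : Fin m → Subset n
    noIsolated : ∀ (v : Fin n) → ∃[ i ] (v ∈ edge i)
open Hypergraph public

data Walk {A : Set} (Adj : A → A → Set) (P : A → Set) : A → A → Set where
  [_]  : ∀ {x} → P x → Walk Adj P x x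
  _∷⟨_⟩_ : ∀ {x y z} → P x → Adj x y → Walk Adj P y z → Walk Adj P x z

data InnerWalk {A : Set} (Adj : A → A → Set) (Q : A → Set) : A → A → Set where
  direct : ∀ {x y} → Adj x y → InnerWalk Adj Q x y
  via    : ∀ {x y z} → Adj x y → Q y → InnerWalk Adj Q y z → InnerWalk Adj Q x z

IsSeparator : {A : Set} (Vtx : A → Set) (Adj : A → A → Set)
              (S : A → Set) (s t : A) → Set
IsSeparator {A} Vtx Adj S s t =
  (∀ x → S x → Vtx x) × ¬ S s × ¬ S t ×
  ¬ Walk Adj (λ x → Vtx x × ¬ S x) s t

module _ {n m : ℕ} (H : Hypergraph n m) where

  HAdj : Fin n → Fin n → Set
  HAdj u v = ∃[ i ] (u ∈ edge H i × v ∈ edge H i)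

  HVtx : Fin n → Set
  HVtx _ = ⊤

  HSeparator : Subset n → Fin n → Fin n → Set
  HSeparator S s t = IsSeparator HVtx HAdj (_∈ S) s t

  EdgeCoverAtMost : Subset n → ℕ → Set
  EdgeCoverAtMost S k =
    ∃[ C ] (length C ≤ k × (∀ v → v ∈ S → ∃[ i ] (i ∈ₗ C × v ∈ edge H i)))

  module _ (U : Subset n) where

    TorsoAdj : Fin n → Fin n → Set
    TorsoAdj u v = u ∈ U × v ∈ U × u ≢ v × InnerWalk HAdj (_∉ U) u v

    -- vertices of Torso*(H,U): inj₁ v for v ∈ U (the vertices of Torso(H,U)),
    -- inj₂ i for each hyperedge e_i meeting U (the new vertex u_i)
    TVertex : Set
    TVertex = Fin n ⊎ Fin m

    TVtx : TVertex → Set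
    TVtx (inj₁ v) = v ∈ U
    TVtx (inj₂ i) = ∃[ v ] (v ∈ U × v ∈ edge H i)

    NewVtx : TVertex → Set
    NewVtx (inj₁ _) = ⊥
    NewVtx (inj₂ i) = TVtx (inj₂ i)

    TAdj : TVertex → TVertex → Set
    TAdj (inj₁ u) (inj₁ v) = TorsoAdj u v
    TAdj (inj₁ u) (inj₂ i) = TVtx (inj₂ i) × u ∈ U × u ∈ edge H i
    TAdj (inj₂ i) (inj₁ u) = TVtx (inj₂ i) × u ∈ U × u ∈ edge H i
    TAdj (inj₂ _) (inj₂ _) = ⊥

    embed : Subset n → TVertex → Set
    embed S (inj₁ v) = v ∈ S
    embed S (inj₂ _) = ⊥

    TSeparator : Subset n → Fin n → Fin n → Set
    TSeparator S s t = IsSeparator TVtx TAdj (embed S) (inj₁ s) (inj₁ t)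

    DominatedByNew : Subset n → ℕ → Set
    DominatedByNew S k =
      ∃[ D ] (length D ≤ k × (∀ d → d ∈ₗ D → NewVtx d) ×
              (∀ v → v ∈ S → ∃[ d ] (d ∈ₗ D × TAdj (inj₁ v) d)))

{-# OPTIONS --safe #-}
-- A walk in Torso*(H,U) between vertices of U ∖ S avoiding S lifts to H: a torso edge is an
-- H-path through vertices outside U ⊇ S, and a detour through a new vertex u_i is a single
-- step inside e_i. Conversely, an H-walk avoiding S is cut at its visits to U; each segment
-- between consecutive visits is a torso edge. For the cost condition, a hyperedge covering a
-- vertex of S ⊆ U meets U, so its new vertex exists and dominates that vertex, and the
-- hyperedges behind dominating new vertices cover S.
module Submission where

open import Defs
open import Data.Nat using (ℕ; _≤_)
open import Data.Nat.Properties using (≤-trans; ≤-reflexive)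
open import Data.Fin using (Fin)
open import Data.Fin.Properties using (any?) renaming (_≟_ to _≟ᶠ_)
open import Data.Fin.Subset using (Subset; _∈_; _∉_; _⊆_)
open import Data.Fin.Subset.Properties using (_∈?_)
open import Data.Product using (∃-syntax; _×_; _,_; proj₁; proj₂)
open import Data.Product.Function.NonDependent.Propositional using (_×-⇔_)
open import Data.Sum using (_⊎_; inj₁; inj₂)
open import Data.Empty using (⊥-elim)
open import Data.Unit using (tt)
open import Data.Maybe using (Maybe; just; nothing)
import Data.Maybe.Relation.Unary.Any as Maybe
open import Data.List using (List; map; filter; mapMaybe; length)
open import Data.List.Properties using (length-map; length-filter; length-mapMaybe)
open import Data.List.Membership.Propositional using () renaming (_∈_ to _∈ₗ_)
open import Data.List.Membership.Propositional.Properties using (∈-map⁺; ∈-map⁻; ∈-filter⁺; ∈-filter⁻)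
open import Data.List.Relation.Unary.Any.Properties using (gmap; mapMaybe⁺)
open import Relation.Nullary using (¬_; Dec; yes; no)
open import Relation.Nullary.Decidable using (_×-dec_)
open import Relation.Binary.PropositionalEquality using (_≡_; refl)
open import Function.Bundles using (_⇔_; mk⇔)

module _ {A : Set} {Adj : A → A → Set} {P : A → Set} where

  walk-head : ∀ {u v} → Walk Adj P u v → P u
  walk-head [ pu ]       = pu
  walk-head (pu ∷⟨ _ ⟩ _) = pu

  innerWalk-++ : ∀ {Q : A → Set} → (∀ {x} → Q x → P x) → ∀ {u v w} →
                 P u → InnerWalk Adj Q u v → Walk Adj P v w → Walk Adj P u w
  innerWalk-++ Q⇒P pu (direct a)     w = pu ∷⟨ a ⟩ w
  innerWalk-++ Q⇒P pu (via a qy iw) w = pu ∷⟨ a ⟩ innerWalk-++ Q⇒P (Q⇒P qy) iw w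

module Torso* {n m : ℕ} (H : Hypergraph n m) (U : Subset n) where

  MeetsU : Fin m → Set
  MeetsU i = TVtx H U (inj₂ i)

  meetsU? : (i : Fin m) → Dec (MeetsU i)
  meetsU? i = any? (λ v → (v ∈? U) ×-dec (v ∈? edge H i))

  module Avoiding (S : Subset n) (S⊆U : S ⊆ U) where

    HWalk : Fin n → Fin n → Set
    HWalk = Walk (HAdj H) (λ x → HVtx H x × x ∉ S)

    TWalk : Fin n → Fin n → Set
    TWalk u v = Walk (TAdj H U) (λ x → TVtx H U x × ¬ embed H U S x) (inj₁ u) (inj₁ v)

    OutsideU : Fin n → Fin n → Set
    OutsideU = InnerWalk (HAdj H) (_∉ U)

    _⇝_ : Fin n → Fin n → Set
    u ⇝ y = u ≡ y ⊎ OutsideU u y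

    tWalk⇒hWalk : ∀ {u v} → TWalk u v → HWalk u v
    tWalk⇒hWalk [ _ , u∉S ] = [ tt , u∉S ]
    tWalk⇒hWalk (_∷⟨_⟩_ {y = inj₁ _} (_ , u∉S) (_ , _ , _ , iw) w) =
      innerWalk-++ (λ x∉U → tt , λ x∈S → x∉U (S⊆U x∈S)) (tt , u∉S) iw (tWalk⇒hWalk w)
    tWalk⇒hWalk (_∷⟨_⟩_ {y = inj₂ i} (_ , u∉S) (_ , _ , u∈eᵢ)
                  (_∷⟨_⟩_ {y = inj₁ _} _ (_ , _ , y∈eᵢ) w)) =
      (tt , u∉S) ∷⟨ i , u∈eᵢ , y∈eᵢ ⟩ tWalk⇒hWalk w

    tWalk-cons : ∀ {u y v} → u ∈ U → u ∉ S → u ⇝ y → TWalk y v → TWalk u v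
    tWalk-cons u∈U u∉S (inj₁ refl) w = w
    tWalk-cons {u} {y} u∈U u∉S (inj₂ iw) w with u ≟ᶠ y
    ... | yes refl = w
    ... | no u≢y   = (u∈U , u∉S) ∷⟨ u∈U , proj₁ (walk-head w) , u≢y , iw ⟩ w

    hWalk⇒exit : ∀ {x v} → v ∈ U → HWalk x v → ∃[ y ] (x ⇝ y × TWalk y v)
    hWalk⇒exit v∈U [ _ , v∉S ] = _ , inj₁ refl , [ v∈U , v∉S ]
    hWalk⇒exit v∈U (_∷⟨_⟩_ {y = y} _ a w) with hWalk⇒exit v∈U w | y ∈? U
    ... | z , y⇝z , tw | yes y∈U =
      y , inj₂ (direct a) , tWalk-cons y∈U (proj₂ (walk-head w)) y⇝z tw
    ... | z , inj₁ refl , tw | no y∉U = z , inj₂ (direct a) , tw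
    ... | z , inj₂ iw , tw   | no y∉U = z , inj₂ (via a y∉U iw) , tw

    hWalk⇒tWalk : ∀ {u v} → u ∈ U → v ∈ U → HWalk u v → TWalk u v
    hWalk⇒tWalk u∈U v∈U w with hWalk⇒exit v∈U w
    ... | _ , u⇝y , tw = tWalk-cons u∈U (proj₂ (walk-head w)) u⇝y tw

    separator⇔ : ∀ {s t} → s ∈ U → t ∈ U → s ∉ S → t ∉ S →
                 HSeparator H S s t ⇔ TSeparator H U S s t
    separator⇔ s∈U t∈U s∉S t∉S = mk⇔
      (λ (_ , _ , _ , no-hWalk) →
         embed⊆TVtx , s∉S , t∉S , λ w → no-hWalk (tWalk⇒hWalk w))
      (λ (_ , _ , _ , no-tWalk) →
         (λ _ _ → tt) , s∉S , t∉S , λ w → no-tWalk (hWalk⇒tWalk s∈U t∈U w))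
      where
      embed⊆TVtx : ∀ x → embed H U S x → TVtx H U x
      embed⊆TVtx (inj₁ _) x∈S = S⊆U x∈S

    edgeCover⇒dominatedByNew : ∀ {k} → EdgeCoverAtMost H S k → DominatedByNew H U S k
    edgeCover⇒dominatedByNew (C , |C|≤k , covers) =
      D , ≤-trans |D|≤|C| |C|≤k , new , dominates
      where
      D : List (TVertex H U)
      D = map inj₂ (filter meetsU? C)

      |D|≤|C| : length D ≤ length C
      |D|≤|C| = ≤-trans (≤-reflexive (length-map inj₂ (filter meetsU? C)))
                        (length-filter meetsU? C)

      new : ∀ d → d ∈ₗ D → NewVtx H U d
      new d d∈D with ∈-map⁻ inj₂ d∈D
      ... | i , i∈ , refl = proj₂ (∈-filter⁻ meetsU? {xs = C} i∈)

      dominates : ∀ v → v ∈ S → ∃[ d ] (d ∈ₗ D × TAdj H U (inj₁ v) d)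
      dominates v v∈S with covers v v∈S
      ... | i , i∈C , v∈eᵢ =
        inj₂ i , ∈-map⁺ inj₂ (∈-filter⁺ meetsU? {xs = C} i∈C eᵢ∩U) , eᵢ∩U , S⊆U v∈S , v∈eᵢ
        where eᵢ∩U = v , S⊆U v∈S , v∈eᵢ

    hyperedgeOf : TVertex H U → Maybe (Fin m)
    hyperedgeOf (inj₁ _) = nothing
    hyperedgeOf (inj₂ i) = just i

    dominatedByNew⇒edgeCover : ∀ {k} → DominatedByNew H U S k → EdgeCoverAtMost H S k
    dominatedByNew⇒edgeCover (D , |D|≤k , new , dominates) =
      mapMaybe hyperedgeOf D , ≤-trans (length-mapMaybe hyperedgeOf D) |D|≤k , covers
      where
      covers : ∀ v → v ∈ S → ∃[ i ] (i ∈ₗ mapMaybe hyperedgeOf D × v ∈ edge H i)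
      covers v v∈S with dominates v v∈S
      ... | inj₁ w , w∈D , _ = ⊥-elim (new (inj₁ w) w∈D)
      ... | inj₂ i , i∈D , (_ , _ , v∈eᵢ) =
        i , mapMaybe⁺ hyperedgeOf D (gmap (λ { refl → Maybe.just refl }) i∈D) , v∈eᵢ

    edgeCover⇔dominatedByNew : ∀ {k} → EdgeCoverAtMost H S k ⇔ DominatedByNew H U S k
    edgeCover⇔dominatedByNew = mk⇔ edgeCover⇒dominatedByNew dominatedByNew⇒edgeCover

mainTheorem18 : ∀ {n m : ℕ} (H : Hypergraph n m) (k : ℕ) (U : Subset n)
                (s t : Fin n) → s ∈ U → t ∈ U →
                (S : Subset n) → S ⊆ U → s ∉ S → t ∉ S →
                (HSeparator H S s t × EdgeCoverAtMost H S k)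
                  ⇔ (TSeparator H U S s t × DominatedByNew H U S k)
mainTheorem18 H k U s t s∈U t∈U S S⊆U s∉S t∉S =
  separator⇔ s∈U t∈U s∉S t∉S ×-⇔ edgeCover⇔dominatedByNew
  where open Torso*.Avoiding H U S S⊆U
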